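{- Let $w\in\widetilde{S}_n$ avoid the patterns $3412$ and $4231$, and suppose $w$ has a factoring subword $x$. Then $\Psi(w)$ (defined from $x$ as in the context) also avoids $3412$ and $4231$.
   Context: $\widetilde{S}_n$ is the set of bijections $w:\mathbb{Z}\to\mathbb{Z}$ with $w(i+n)=w(i)+n$ and $\sum_{i=1}^n w(i)=\binom{n+1}{2}$; write $w_i=w(i)$. Pattern containment: $w$ contains $p\in S_k$ if there exist integers $i_1<\dots<i_k$ with $w_{i_1},\dots,w_{i_k}$ in the same relative order as $p$; otherwise $w$ avoids $p$. A factoring subword of $w$ is a consecutive subsequence $x=x_1\cdots x_k=w_{q+1}\cdots w_{q+k}$ ($k\ge1$) such that: (1) $x_1>\dots>x_k$; (2) $x_1>w_i$ for all $i\le q$; (3) $x_k<w_i$ for all $i>q+k$; (4) if $x_k>w_i$ for all $i\le q$, then $w_i>x_1$ for all $i>q+k$. The pivot index $j$ is the largest $j\in\{1,\dots,k\}$ such that no $w_i$ with $i\le q$ exceeds $x_j$; if this largest value equals $k$, set $j=1$ instead. $\Psi(w)$ is the element of $\widetilde{S}_n$ obtained from $w$ by replacing the values $x_1\cdots x_k$ in positions $q+1,\dots,q+k$ by $x_{j+1}\cdots x_k\,x_1\cdots x_j$ (and correspondingly in all translates by multiples of $n$). -}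

module Defs where

open import Data.Nat as ℕ using (ℕ; zero; suc; NonZero)
open import Data.Nat.Combinatorics using (_C_)
open import Data.Integer as ℤ using (ℤ; +_; _+_; _-_; _<_; _≤_; _>_)
open import Data.Integer.DivMod using (_%ℕ_)
open import Data.Fin as Fin using (Fin)
open import Data.Vec using (Vec; _∷_; []; lookup)
open import Data.Product using (Σ; ∃; _×_; _,_)
open import Data.Bool using (if_then_else_)
open import Relation.Nullary using (¬_)
open import Relation.Nullary.Decidable using (⌊_⌋)
open import Relation.Binary.PropositionalEquality using (_≡_)

sum1 : (ℤ → ℤ) → ℕ → ℤ
sum1 f zero    = + 0
sum1 f (suc m) = sum1 f m + f (+ suc m)

record IsAffinePerm (n : ℕ) (w : ℤ → ℤ) : Set where
  field
    injective  : ∀ a b → w a ≡ w b → a ≡ b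
    surjective : ∀ y → ∃ λ x → w x ≡ y
    periodic   : ∀ i → w (i + + n) ≡ w i + + n
    window-sum : sum1 w n ≡ + (suc n C 2)

-- w contains the pattern p ∈ S_k (given by its one-line notation p : Fin k → ℕ)
Contains : (ℤ → ℤ) → (k : ℕ) → (Fin k → ℕ) → Set
Contains w k p =
  Σ (Fin k → ℤ) λ f →
    (∀ a b → a Fin.< b → f a < f b) ×
    (∀ a b → (p a ℕ.< p b → w (f a) < w (f b)) × (w (f a) < w (f b) → p a ℕ.< p b))

Avoids : (ℤ → ℤ) → (k : ℕ) → (Fin k → ℕ) → Set
Avoids w k p = ¬ Contains w k p

p3412 : Fin 4 → ℕ
p3412 = lookup (3 ∷ 4 ∷ 1 ∷ 2 ∷ [])

p4231 : Fin 4 → ℕ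
p4231 = lookup (4 ∷ 2 ∷ 3 ∷ 1 ∷ [])

xval : (ℤ → ℤ) → ℤ → ℕ → ℤ
xval w q j = w (q + + j)

-- x = w_{q+1} ... w_{q+k} is a factoring subword of w
record IsFactoringSubword (w : ℤ → ℤ) (q : ℤ) (k : ℕ) : Set where
  field
    k≥1        : 1 ℕ.≤ k
    decreasing : ∀ j → 1 ℕ.≤ j → j ℕ.< k → xval w q j > xval w q (suc j)
    left       : ∀ i → i ≤ q → xval w q 1 > w i
    right      : ∀ i → q + + k < i → xval w q k < w i
    cond4      : (∀ i → i ≤ q → xval w q k > w i) → ∀ i → q + + k < i → w i > xval w q 1

NoExceed : (ℤ → ℤ) → ℤ → ℕ → Set
NoExceed w q j = ∀ i → i ≤ q → ¬ (w i > xval w q j)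

IsLargestNoExceed : (ℤ → ℤ) → ℤ → ℕ → ℕ → Set
IsLargestNoExceed w q k j =
  (1 ℕ.≤ j) × (j ℕ.≤ k) × NoExceed w q j ×
  (∀ j′ → j ℕ.< j′ → j′ ℕ.≤ k → ¬ NoExceed w q j′)

pivotFrom : ℕ → ℕ → ℕ
pivotFrom k j = if ⌊ j ℕ.≟ k ⌋ then 1 else j

-- Ψ(w): positions q+1..q+k (and translates by multiples of n) get
-- x_{j+1} ... x_k x_1 ... x_j; all other positions unchanged.
-- For i with r = (i - q - 1) mod n < k (position q+1+r of a translate):
--   if r < k - j the new value is x_{j+1+r} (translated), i.e. w(i + j);
--   otherwise it is x_{r+1-(k-j)} (translated), i.e. w(i - (k - j)).
Psi : (n : ℕ) → .{{NonZero n}} → (ℤ → ℤ) → ℤ → ℕ → ℕ → (ℤ → ℤ)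
Psi n w q k j i =
  let r = (i - q - + 1) %ℕ n in
  if ⌊ r ℕ.<? k ⌋
    then (if ⌊ r ℕ.<? k ℕ.∸ j ⌋ then w (i + + j) else w (i - + (k ℕ.∸ j)))
    else w i

-- Ψ(w) = w ∘ σ, where σ rotates the first k positions of every translate of the window
-- q+1 … q+n. Along σ the order of positions is kept except for pairs i < i′ in one translate
-- with i receiving one of x_{j+1} … x_k and i′ one of x_1 … x_j. By the choice of the pivot j,
-- everything left of x lies below x_j and everything right of x above x_{j+1}, so such a pair
-- is an ascent of Ψ(w) with all earlier values below Ψ(w)(i′) and all later values above
-- Ψ(w)(i). Two consecutive entries of a 3412 or 4231 never form such an ascent, so σ is
-- increasing along any occurrence of these patterns in Ψ(w) and carries it to one in w.

module Submission where

open import Defs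
open import Data.Nat as N using (ℕ; NonZero; zero; suc; z≤n; s≤s)
import Data.Nat.Properties as NP
open import Data.Integer using (ℤ; +_; -_; -[1+_]; _+_; _-_; _*_; _<_; _≤_; +<+; +≤+; _/ℕ_; _%ℕ_)
open import Data.Integer using () renaming (suc to sucℤ)
import Data.Integer.Properties as ZP
open import Data.Integer.DivMod using (a≡a%ℕn+[a/ℕn]*n; n%ℕd<d)
open import Data.Integer.Tactic.RingSolver using (solve-∀)
open import Data.Fin as Fin using (Fin; inject₁)
open import Data.Fin.Patterns using (0F; 1F; 2F; 3F)
import Data.Fin.Properties as FP
open import Data.Vec using (_∷_; []; lookup)
open import Data.Product using (_×_; _,_; proj₂)
open import Data.Sum using (_⊎_; inj₁; inj₂)
open import Data.Empty using (⊥-elim)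
open import Data.Bool using (if_then_else_)
open import Data.Bool.Properties using (if-cong)
open import Function using (_∘_)
open import Relation.Nullary using (¬_; Dec; yes; no)
open import Relation.Nullary.Decidable using (⌊_⌋; dec-true; dec-false; isYes≗does; from-yes; from-no; _→-dec_)
open import Relation.Binary.PropositionalEquality using (_≡_; refl; sym; trans; cong; subst; subst₂; module ≡-Reasoning)
open import Relation.Binary.Definitions using (tri<; tri≈; tri>)

if-yes : ∀ {A P : Set} (P? : Dec P) {x y : A} → P → (if ⌊ P? ⌋ then x else y) ≡ x
if-yes P? p = if-cong (trans (isYes≗does P?) (dec-true P? p))

if-no : ∀ {A P : Set} (P? : Dec P) {x y : A} → ¬ P → (if ⌊ P? ⌋ then x else y) ≡ y
if-no P? ¬p = if-cong (trans (isYes≗does P?) (dec-false P? ¬p))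

Increasing : ∀ {k} → (Fin k → ℤ) → Set
Increasing f = ∀ a b → a Fin.< b → f a < f b

SameOrder : ∀ {k} → (Fin k → ℕ) → (Fin k → ℤ) → Set
SameOrder p v = ∀ a b → (p a N.< p b → v a < v b) × (v a < v b → p a N.< p b)

increasing-from-consecutive : ∀ {k} (f : Fin (suc k) → ℤ) →
                              (∀ a → f (inject₁ a) < f (Fin.suc a)) → Increasing f
increasing-from-consecutive {suc k} f step 0F (Fin.suc 0F) _ = step 0F
increasing-from-consecutive {suc k} f step 0F (Fin.suc (Fin.suc b)) _ =
  ZP.<-trans (step 0F) (increasing-from-consecutive (f ∘ Fin.suc) (step ∘ Fin.suc) 0F (Fin.suc b) (s≤s z≤n))
increasing-from-consecutive {suc k} f step (Fin.suc a) (Fin.suc b) (s≤s a<b) =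
  increasing-from-consecutive (f ∘ Fin.suc) (step ∘ Fin.suc) a b a<b

sameOrder-from-< : ∀ {k} {p : Fin k → ℕ} {v : Fin k → ℤ} → (∀ a b → p a ≡ p b → a ≡ b) →
                   (∀ a b → p a N.< p b → v a < v b) → SameOrder p v
sameOrder-from-< {p = p} {v} p-injective p<⇒v< a b = p<⇒v< a b , v<⇒p<
  where
  v<⇒p< : v a < v b → p a N.< p b
  v<⇒p< va<vb with NP.<-cmp (p a) (p b)
  ... | tri< pa<pb _ _ = pa<pb
  ... | tri≈ _ pa≡pb _ with refl ← p-injective a b pa≡pb = ⊥-elim (ZP.<-irrefl refl va<vb)
  ... | tri> _ _ pb<pa = ⊥-elim (ZP.<-asym va<vb (p<⇒v< b a pb<pa))

record SeparatingAscent (v : ℤ → ℤ) (i i′ : ℤ) : Set where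
  field
    ascent      : v i < v i′
    left-below  : ∀ t → t < i → v t < v i′
    right-above : ∀ t → i′ < t → v i < v t

avoids-reindex : ∀ {k} {p : Fin (suc k) → ℕ} {w v σ : ℤ → ℤ} →
                 (∀ i → v i ≡ w (σ i)) →
                 (∀ {i i′} → i < i′ → ¬ σ i < σ i′ → SeparatingAscent v i i′) →
                 (∀ {f} → Increasing f → SameOrder p (v ∘ f) →
                  ∀ a → ¬ SeparatingAscent v (f (inject₁ a)) (f (Fin.suc a))) →
                 Avoids w (suc k) p → Avoids v (suc k) p
avoids-reindex {p = p} {w} {v} {σ} v≡w∘σ inversion-separates no-separating avoids (f , f↑ , order) =
  avoids (σ ∘ f , increasing-from-consecutive (σ ∘ f) σ∘f-step , order-in-w)
  where
  σ∘f-step : ∀ a → σ (f (inject₁ a)) < σ (f (Fin.suc a))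
  σ∘f-step a with σ (f (inject₁ a)) ZP.<? σ (f (Fin.suc a))
  ... | yes ascent = ascent
  ... | no ¬ascent = ⊥-elim (no-separating f↑ order a
          (inversion-separates (f↑ _ _ (FP.≤̄⇒inject₁< NP.≤-refl)) ¬ascent))

  order-in-w : SameOrder p (w ∘ σ ∘ f)
  order-in-w a b = subst₂ (λ x y → (p a N.< p b → x < y) × (x < y → p a N.< p b))
                          (v≡w∘σ (f a)) (v≡w∘σ (f b)) (order a b)

p3412-injective : ∀ a b → p3412 a ≡ p3412 b → a ≡ b
p3412-injective = from-yes (FP.all? λ a → FP.all? λ b → (p3412 a N.≟ p3412 b) →-dec (a FP.≟ b))

-- 3412 is an involution, so reading v along it lists the values in increasing order.
p3412-realised : ∀ (v : Fin 4 → ℤ) → v 2F < v 3F → v 3F < v 0F → v 0F < v 1F →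
                 ∀ a b → p3412 a N.< p3412 b → v a < v b
p3412-realised v v₂<v₃ v₃<v₀ v₀<v₁ a b pa<pb =
  subst₂ _<_ (cong v (π-involutive a)) (cong v (π-involutive b))
         (v∘π-increasing (π a) (π b) (p-order⇒π-order a b pa<pb))
  where
  π : Fin 4 → Fin 4
  π = lookup (2F ∷ 3F ∷ 0F ∷ 1F ∷ [])

  π-involutive : ∀ a → π (π a) ≡ a
  π-involutive = from-yes (FP.all? λ a → π (π a) FP.≟ a)

  p-order⇒π-order : ∀ a b → p3412 a N.< p3412 b → π a Fin.< π b
  p-order⇒π-order = from-yes (FP.all? λ a → FP.all? λ b → (p3412 a N.<? p3412 b) →-dec (π a FP.<? π b))

  v∘π-increasing : Increasing (v ∘ π)
  v∘π-increasing =
    increasing-from-consecutive (v ∘ π) λ { 0F → v₂<v₃ ; 1F → v₃<v₀ ; 2F → v₀<v₁ }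

occurrence-3412 : ∀ {w : ℤ → ℤ} {i₁ i₂ i₃ i₄} → i₁ < i₂ → i₂ < i₃ → i₃ < i₄ →
                  w i₃ < w i₄ → w i₄ < w i₁ → w i₁ < w i₂ → Contains w 4 p3412
occurrence-3412 {w} {i₁} {i₂} {i₃} {i₄} i₁<i₂ i₂<i₃ i₃<i₄ w₃<w₄ w₄<w₁ w₁<w₂ =
  f , increasing-from-consecutive f (λ { 0F → i₁<i₂ ; 1F → i₂<i₃ ; 2F → i₃<i₄ }) ,
  sameOrder-from-< p3412-injective (p3412-realised (w ∘ f) w₃<w₄ w₄<w₁ w₁<w₂)
  where
  f : Fin 4 → ℤ
  f = lookup (i₁ ∷ i₂ ∷ i₃ ∷ i₄ ∷ [])

p3412-no-separating-ascent : ∀ {v f} → Increasing f → SameOrder p3412 (v ∘ f) →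
                             ∀ a → ¬ SeparatingAscent v (f (inject₁ a)) (f (Fin.suc a))
p3412-no-separating-ascent f↑ order 0F s =
  from-no (3 N.<? 1) (proj₂ (order 0F 2F) (SeparatingAscent.right-above s _ (f↑ 1F 2F NP.≤-refl)))
p3412-no-separating-ascent f↑ order 1F s =
  from-no (4 N.<? 1) (proj₂ (order 1F 2F) (SeparatingAscent.ascent s))
p3412-no-separating-ascent f↑ order 2F s =
  from-no (3 N.<? 2) (proj₂ (order 0F 3F) (SeparatingAscent.left-below s _ (f↑ 0F 2F (s≤s z≤n))))

p4231-no-separating-ascent : ∀ {v f} → Increasing f → SameOrder p4231 (v ∘ f) →
                             ∀ a → ¬ SeparatingAscent v (f (inject₁ a)) (f (Fin.suc a))
p4231-no-separating-ascent f↑ order 0F s =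
  from-no (4 N.<? 2) (proj₂ (order 0F 1F) (SeparatingAscent.ascent s))
p4231-no-separating-ascent f↑ order 1F s =
  from-no (4 N.<? 3) (proj₂ (order 0F 2F) (SeparatingAscent.left-below s _ (f↑ 0F 1F NP.≤-refl)))
p4231-no-separating-ascent f↑ order 2F s =
  from-no (3 N.<? 1) (proj₂ (order 2F 3F) (SeparatingAscent.ascent s))

x-ab+ab≡x : ∀ x a b → x + - a * b + a * b ≡ x
x-ab+ab≡x = solve-∀

x+ab-ab≡x : ∀ x a b → x + a * b + - a * b ≡ x
x+ab-ab≡x = solve-∀

module Periodic (n : ℕ) (w : ℤ → ℤ) (periodic : ∀ i → w (i + + n) ≡ w i + + n) where
  open ≡-Reasoning

  shift-by-ℕ-multiple : ∀ i t → w (i + + t * + n) ≡ w i + + t * + n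
  shift-by-ℕ-multiple i zero = trans (cong w (ZP.+-identityʳ i)) (sym (ZP.+-identityʳ (w i)))
  shift-by-ℕ-multiple i (suc t) = begin
    w (i + + suc t * + n)       ≡⟨ cong w (one-more i) ⟩
    w (i + + t * + n + + n)     ≡⟨ periodic _ ⟩
    w (i + + t * + n) + + n     ≡⟨ cong (_+ + n) (shift-by-ℕ-multiple i t) ⟩
    w i + + t * + n + + n       ≡⟨ one-more (w i) ⟨
    w i + + suc t * + n         ∎
    where
    one-more : ∀ x → x + + suc t * + n ≡ x + + t * + n + + n
    one-more x = trans (cong (λ y → x + y) (ZP.suc-* (+ t) (+ n))) (swap x (+ n) (+ t * + n))
      where
      swap : ∀ x a b → x + (a + b) ≡ x + b + a
      swap = solve-∀

  shift-by-multiple : ∀ i m → w (i + m * + n) ≡ w i + m * + n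
  shift-by-multiple i (+ t) = shift-by-ℕ-multiple i t
  shift-by-multiple i m@(-[1+ t ]) = begin
    w j                             ≡⟨ x+ab-ab≡x (w j) (+ suc t) (+ n) ⟨
    w j + + suc t * + n + m * + n   ≡⟨ cong (_+ m * + n) (shift-by-ℕ-multiple j (suc t)) ⟨
    w (j + + suc t * + n) + m * + n ≡⟨ cong (λ z → w z + m * + n) (x-ab+ab≡x i (+ suc t) (+ n)) ⟩
    w i + m * + n                   ∎
    where
    j = i + m * + n

  w-unshift : ∀ u M → w (u + - M * + n) + M * + n ≡ w u
  w-unshift u M = trans (sym (shift-by-multiple (u + - M * + n) M)) (cong w (x-ab+ab≡x u M (+ n)))

  below-shifted : ∀ {q y} → (∀ u → u ≤ q → w u < y) → ∀ M u → u ≤ q + M * + n → w u < y + M * + n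
  below-shifted {q} {y} bound M u u≤q+Mn =
    subst (_< y + M * + n) (w-unshift u M) (ZP.+-monoˡ-< (M * + n) (bound _ u₀≤q))
    where
    u₀≤q : u + - M * + n ≤ q
    u₀≤q = subst (u + - M * + n ≤_) (x+ab-ab≡x q M (+ n)) (ZP.+-monoˡ-≤ (- M * + n) u≤q+Mn)

  above-shifted : ∀ {q y} → (∀ u → q < u → y < w u) → ∀ M u → q + M * + n < u → y + M * + n < w u
  above-shifted {q} {y} bound M u q+Mn<u =
    subst (y + M * + n <_) (w-unshift u M) (ZP.+-monoˡ-< (M * + n) (bound _ q<u₀))
    where
    q<u₀ : q < u + - M * + n
    q<u₀ = subst (_< u + - M * + n) (x+ab-ab≡x q M (+ n)) (ZP.+-monoˡ-< (- M * + n) q+Mn<u)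

-- Every i is q + 1 + offset i + block i · n with offset i < n; Psi reads the same offset.
module Blocks (n : ℕ) .{{_ : NonZero n}} (q : ℤ) where

  offset : ℤ → ℕ
  offset i = (i - q - + 1) %ℕ n

  block : ℤ → ℤ
  block i = (i - q - + 1) /ℕ n

  position : ℕ → ℤ → ℤ
  position s M = q + (+ suc s + M * + n)

  offset<n : ∀ i → offset i N.< n
  offset<n i = n%ℕd<d (i - q - + 1) n

  position-offset-block : ∀ i → position (offset i) (block i) ≡ i
  position-offset-block i = begin
    q + (+ 1 + + offset i + block i * + n)   ≡⟨ regroup q (+ offset i) (block i * + n) ⟩
    q + + 1 + (+ offset i + block i * + n)   ≡⟨ cong (λ d → q + + 1 + d) (a≡a%ℕn+[a/ℕn]*n (i - q - + 1) n) ⟨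
    q + + 1 + (i - q - + 1)                  ≡⟨ cancel i q ⟩
    i                                        ∎
    where
    open ≡-Reasoning
    regroup : ∀ q r x → q + (+ 1 + r + x) ≡ q + + 1 + (r + x)
    regroup = solve-∀
    cancel : ∀ i q → q + + 1 + (i - q - + 1) ≡ i
    cancel = solve-∀

  s+Mn≤M′n : ∀ {s M M′} → s N.≤ n → M < M′ → + s + M * + n ≤ M′ * + n
  s+Mn≤M′n {s} {M} {M′} s≤n M<M′ = begin
    + s + M * + n     ≤⟨ ZP.+-monoˡ-≤ (M * + n) (+≤+ s≤n) ⟩
    + n + M * + n     ≡⟨ ZP.suc-* M (+ n) ⟨
    sucℤ M * + n      ≤⟨ ZP.*-monoʳ-≤-nonNeg (+ n) (ZP.i<j⇒suc[i]≤j M<M′) ⟩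
    M′ * + n          ∎
    where open ZP.≤-Reasoning

  position-<-block : ∀ {s s′ M M′} → s N.< n → M < M′ → position s M < position s′ M′
  position-<-block {s} {s′} {M} {M′} s<n M<M′ = ZP.+-monoʳ-< q (begin-strict
    + suc s + M * + n     ≤⟨ s+Mn≤M′n s<n M<M′ ⟩
    M′ * + n              ≡⟨ ZP.+-identityˡ (M′ * + n) ⟨
    + 0 + M′ * + n        <⟨ ZP.+-monoˡ-< (M′ * + n) (+<+ (s≤s z≤n)) ⟩
    + suc s′ + M′ * + n   ∎)
    where open ZP.≤-Reasoning

  position-<-offset : ∀ {s s′} M → s N.< s′ → position s M < position s′ M
  position-<-offset M s<s′ = ZP.+-monoʳ-< q (ZP.+-monoˡ-< (M * + n) (+<+ (s≤s s<s′)))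

  position-≤-offset : ∀ {s s′} M → s N.≤ s′ → position s M ≤ position s′ M
  position-≤-offset M s≤s′ = ZP.+-monoʳ-≤ q (ZP.+-monoˡ-≤ (M * + n) (+≤+ (s≤s s≤s′)))

  position-before-block : ∀ {s M′ M} → s N.< n → M′ < M → position s M′ ≤ q + M * + n
  position-before-block s<n M′<M = ZP.+-monoʳ-≤ q (s+Mn≤M′n s<n M′<M)

  position-after-block : ∀ {k s M M′} → k N.≤ n → M < M′ → q + + k + M * + n < position s M′
  position-after-block {k} {s} {M} {M′} k≤n M<M′ =
    subst (_< position s M′) (sym (ZP.+-assoc q (+ k) (M * + n))) (ZP.+-monoʳ-< q (begin-strict
      + k + M * + n         ≤⟨ s+Mn≤M′n k≤n M<M′ ⟩
      M′ * + n              ≡⟨ ZP.+-identityˡ (M′ * + n) ⟨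
      + 0 + M′ * + n        <⟨ ZP.+-monoˡ-< (M′ * + n) (+<+ (s≤s z≤n)) ⟩
      + suc s + M′ * + n    ∎))
    where open ZP.≤-Reasoning

  position-+ : ∀ s j M → position s M + + j ≡ position (s N.+ j) M
  position-+ s j M = regroup q (+ s) (+ j) (M * + n)
    where
    regroup : ∀ q r j x → q + (+ 1 + r + x) + j ≡ q + (+ 1 + (r + j) + x)
    regroup = solve-∀

  position-∸ : ∀ {s j} M → j N.≤ s → position s M - + j ≡ position (s N.∸ j) M
  position-∸ {s} {j} M j≤s =
    trans (regroup q (+ s) (+ j) (M * + n))
          (cong (λ d → q + (+ 1 + d + M * + n)) (trans (ZP.m-n≡m⊖n s j) (ZP.⊖-≥ j≤s)))
    where
    regroup : ∀ q r j x → q + (+ 1 + r + x) - j ≡ q + (+ 1 + (r - j) + x)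
    regroup = solve-∀

  <-lex : ∀ {i i′} → i < i′ → block i < block i′ ⊎ (block i ≡ block i′ × offset i N.< offset i′)
  <-lex {i} {i′} i<i′ with ZP.<-cmp (block i) (block i′)
  ... | tri< M<M′ _ _ = inj₁ M<M′
  ... | tri> _ _ M′<M = ⊥-elim (ZP.<-asym i<i′
          (subst₂ _<_ (position-offset-block i′) (position-offset-block i)
                  (position-<-block (offset<n i′) M′<M)))
  ... | tri≈ _ M≡M′ _ with offset i N.<? offset i′
  ...   | yes r<r′ = inj₂ (M≡M′ , r<r′)
  ...   | no r≮r′ = ⊥-elim (ZP.<⇒≱ i<i′
            (subst₂ _≤_ (position-offset-block i′) (position-offset-block i)
                    (subst (λ M → position (offset i′) M ≤ position (offset i) (block i)) M≡M′
                           (position-≤-offset (block i) (NP.≮⇒≥ r≮r′)))))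

module Rotation (k J : ℕ) (J≤k : J N.≤ k) where

  K : ℕ
  K = k N.∸ J

  -- Psi n w q k J puts (a translate of) x_{rotate s + 1} at offset s.
  rotate : ℕ → ℕ
  rotate s = if ⌊ s N.<? k ⌋ then (if ⌊ s N.<? K ⌋ then s N.+ J else s N.∸ K) else s

  data Part (s : ℕ) : Set where
    from-tail : s N.< K → Part s
    from-head : K N.≤ s → s N.< k → Part s
    outside   : k N.≤ s → Part s

  part : ∀ s → Part s
  part s with s N.<? K | s N.<? k
  ... | yes s<K | _       = from-tail s<K
  ... | no s≮K  | yes s<k = from-head (NP.≮⇒≥ s≮K) s<k
  ... | no _    | no s≮k  = outside (NP.≮⇒≥ s≮k)

  K+J≡k : K N.+ J ≡ k
  K+J≡k = NP.m∸n+n≡m J≤k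

  tail<k : ∀ {s} → s N.< K → s N.< k
  tail<k s<K = NP.<-≤-trans s<K (NP.m∸n≤m k J)

  tail+J<k : ∀ {s} → s N.< K → s N.+ J N.< k
  tail+J<k {s} s<K = subst (s N.+ J N.<_) K+J≡k (NP.+-monoˡ-< J s<K)

  head∸K<J : ∀ {s} → K N.≤ s → s N.< k → s N.∸ K N.< J
  head∸K<J {s} K≤s s<k = subst (s N.∸ K N.<_) (NP.m∸[m∸n]≡n J≤k) (NP.∸-monoˡ-< s<k K≤s)

  rotate-tail : ∀ {s} → s N.< K → rotate s ≡ s N.+ J
  rotate-tail {s} s<K = trans (if-yes (s N.<? k) (tail<k s<K))
                              (if-yes (s N.<? K) s<K)

  rotate-head : ∀ {s} → K N.≤ s → s N.< k → rotate s ≡ s N.∸ K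
  rotate-head {s} K≤s s<k = trans (if-yes (s N.<? k) s<k)
                                  (if-no (s N.<? K) (NP.≤⇒≯ K≤s))

  rotate-outside : ∀ {s} → k N.≤ s → rotate s ≡ s
  rotate-outside {s} k≤s = if-no (s N.<? k) (NP.≤⇒≯ k≤s)

  rotate-< : ∀ {n s} → k N.≤ n → s N.< n → rotate s N.< n
  rotate-< {n} {s} k≤n s<n with part s
  ... | from-tail s<K     = subst (N._< n) (sym (rotate-tail s<K)) (NP.<-≤-trans (tail+J<k s<K) k≤n)
  ... | from-head K≤s s<k = subst (N._< n) (sym (rotate-head K≤s s<k)) (NP.≤-<-trans (NP.m∸n≤m s K) s<n)
  ... | outside k≤s       = subst (N._< n) (sym (rotate-outside k≤s)) s<n

  rotate-descent : ∀ {s s′} → s N.< s′ → ¬ rotate s N.< rotate s′ → s N.< K × K N.≤ s′ × s′ N.< k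
  rotate-descent {s} {s′} s<s′ rs≮rs′ with part s | part s′
  ... | from-tail s<K     | from-head K≤s′ s′<k = s<K , K≤s′ , s′<k
  ... | from-tail s<K     | from-tail s′<K      =
    ⊥-elim (rs≮rs′ (subst₂ N._<_ (sym (rotate-tail s<K)) (sym (rotate-tail s′<K))
               (NP.+-monoˡ-< J s<s′)))
  ... | from-tail s<K     | outside k≤s′        =
    ⊥-elim (rs≮rs′ (subst₂ N._<_ (sym (rotate-tail s<K)) (sym (rotate-outside k≤s′))
               (NP.<-≤-trans (tail+J<k s<K) k≤s′)))
  ... | from-head K≤s s<k | from-head K≤s′ s′<k =
    ⊥-elim (rs≮rs′ (subst₂ N._<_ (sym (rotate-head K≤s s<k)) (sym (rotate-head K≤s′ s′<k))
               (NP.∸-monoˡ-< s<s′ K≤s)))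
  ... | from-head K≤s s<k | outside k≤s′        =
    ⊥-elim (rs≮rs′ (subst₂ N._<_ (sym (rotate-head K≤s s<k)) (sym (rotate-outside k≤s′))
               (NP.≤-<-trans (NP.m∸n≤m s K) s<s′)))
  ... | outside k≤s       | outside k≤s′        =
    ⊥-elim (rs≮rs′ (subst₂ N._<_ (sym (rotate-outside k≤s)) (sym (rotate-outside k≤s′))
               s<s′))
  ... | from-head K≤s _   | from-tail s′<K      = ⊥-elim (NP.<-asym s<s′ (NP.<-≤-trans s′<K K≤s))
  ... | outside k≤s       | from-tail s′<K      = ⊥-elim (NP.<-asym s<s′ (NP.<-≤-trans (tail<k s′<K) k≤s))
  ... | outside k≤s       | from-head _ s′<k    = ⊥-elim (NP.<-asym s<s′ (NP.<-≤-trans s′<k k≤s))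

record IsValidPivot (w : ℤ → ℤ) (q : ℤ) (k J : ℕ) : Set where
  field
    1≤J         : 1 N.≤ J
    J≤k         : J N.≤ k
    left-below  : ∀ u → u ≤ q → w u < xval w q J
    right-above : J N.< k → ∀ u → q + + k < u → xval w q (suc J) < w u

module FactoringSubword (n : ℕ) .{{_ : NonZero n}} {w : ℤ → ℤ} (periodic : ∀ i → w (i + + n) ≡ w i + + n)
                        {q : ℤ} {k : ℕ} (fs : IsFactoringSubword w q k) where
  open IsFactoringSubword fs
  open Blocks n q
  open Periodic n w periodic

  x : ℕ → ℤ
  x = xval w q

  x-decreasing : ∀ {a b} → 1 N.≤ a → a N.< b → b N.≤ k → x b < x a
  x-decreasing {a} {suc b} 1≤a a<1+b 1+b≤k with NP.m≤n⇒m<n∨m≡n (N.s≤s⁻¹ a<1+b)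
  ... | inj₂ refl = decreasing a 1≤a 1+b≤k
  ... | inj₁ a<b  = ZP.<-trans (decreasing b (NP.≤-trans 1≤a (NP.<⇒≤ a<b)) 1+b≤k)
                               (x-decreasing 1≤a a<b (NP.<⇒≤ 1+b≤k))

  x-antitone : ∀ {a b} → 1 N.≤ a → a N.≤ b → b N.≤ k → x b ≤ x a
  x-antitone 1≤a a≤b b≤k with NP.m≤n⇒m<n∨m≡n a≤b
  ... | inj₂ refl = ZP.≤-refl
  ... | inj₁ a<b  = ZP.<⇒≤ (x-decreasing 1≤a a<b b≤k)

  -- x₁ > ⋯ > x_k while x_{n+1} = x₁ + n.
  k≤n : k N.≤ n
  k≤n with k N.≤? n
  ... | yes k≤n = k≤n
  ... | no k≰n  =
    ⊥-elim (ZP.<⇒≱ (x-decreasing NP.≤-refl (s≤s (N.>-nonZero⁻¹ n)) (NP.≰⇒> k≰n)) x₁≤xₙ₊₁)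
    where
    x₁≤xₙ₊₁ : x 1 ≤ x (suc n)
    x₁≤xₙ₊₁ = subst (x 1 ≤_) (trans (sym (periodic (q + + 1))) (cong w (ZP.+-assoc q (+ 1) (+ n))))
                    (ZP.i≤i+j (x 1) (+ n))

  w-position : ∀ s M → w (position s M) ≡ x (suc s) + M * + n
  w-position s M = trans (cong w (sym (ZP.+-assoc q (+ suc s) (M * + n))))
                         (shift-by-multiple (q + + suc s) M)

  module Rotated {J : ℕ} (pivot : IsValidPivot w q k J) where
    open IsValidPivot pivot
    open Rotation k J J≤k

    Ψ : ℤ → ℤ
    Ψ = Psi n w q k J

    σ : ℤ → ℤ
    σ i = position (rotate (offset i)) (block i)

    σ-at : ∀ i {s} → rotate (offset i) ≡ s → σ i ≡ position s (block i)
    σ-at i = cong (λ s → position s (block i))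

    Ψ≡w∘σ : ∀ i → Ψ i ≡ w (σ i)
    Ψ≡w∘σ i with part (offset i)
    ... | from-tail r<K = begin
      Ψ i                                       ≡⟨ trans (if-yes (offset i N.<? k) (tail<k r<K))
                                                         (if-yes (offset i N.<? K) r<K) ⟩
      w (i + + J)                               ≡⟨ cong (λ j → w (j + + J)) (position-offset-block i) ⟨
      w (position (offset i) (block i) + + J)   ≡⟨ cong w (position-+ (offset i) J (block i)) ⟩
      w (position (offset i N.+ J) (block i))   ≡⟨ cong w (σ-at i (rotate-tail r<K)) ⟨
      w (σ i)                                   ∎
      where open ≡-Reasoning
    ... | from-head K≤r r<k = begin
      Ψ i                                       ≡⟨ trans (if-yes (offset i N.<? k) r<k)
                                                         (if-no (offset i N.<? K) (NP.≤⇒≯ K≤r)) ⟩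
      w (i - + K)                               ≡⟨ cong (λ j → w (j - + K)) (position-offset-block i) ⟨
      w (position (offset i) (block i) - + K)   ≡⟨ cong w (position-∸ (block i) K≤r) ⟩
      w (position (offset i N.∸ K) (block i))   ≡⟨ cong w (σ-at i (rotate-head K≤r r<k)) ⟨
      w (σ i)                                   ∎
      where open ≡-Reasoning
    ... | outside k≤r = begin
      Ψ i                                       ≡⟨ if-no (offset i N.<? k) (NP.≤⇒≯ k≤r) ⟩
      w i                                       ≡⟨ cong w (position-offset-block i) ⟨
      w (position (offset i) (block i))         ≡⟨ cong w (σ-at i (rotate-outside k≤r)) ⟨
      w (σ i)                                   ∎
      where open ≡-Reasoning

    Ψ-at : ∀ {i s M} → rotate (offset i) ≡ s → block i ≡ M → Ψ i ≡ x (suc s) + M * + n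
    Ψ-at {i} refl refl = trans (Ψ≡w∘σ i) (w-position (rotate (offset i)) (block i))

    record Inversion (i i′ : ℤ) : Set where
      field
        same-block   : block i ≡ block i′
        i-from-tail  : offset i N.< K
        i′-from-head : K N.≤ offset i′
        i′-inside    : offset i′ N.< k

    σ-inversion : ∀ {i i′} → i < i′ → ¬ σ i < σ i′ → Inversion i i′
    σ-inversion {i} {i′} i<i′ σi≮σi′ with <-lex i<i′
    ... | inj₁ M<M′ = ⊥-elim (σi≮σi′ (position-<-block (rotate-< k≤n (offset<n i)) M<M′))
    ... | inj₂ (M≡M′ , r<r′) with rotate (offset i) N.<? rotate (offset i′)
    ...   | yes ρr<ρr′ = ⊥-elim (σi≮σi′ (subst (λ M → σ i < position (rotate (offset i′)) M) M≡M′
                                             (position-<-offset (block i) ρr<ρr′)))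
    ...   | no ρr≮ρr′ with rotate-descent r<r′ ρr≮ρr′
    ...     | r<K , K≤r′ , r′<k =
      record { same-block = M≡M′ ; i-from-tail = r<K ; i′-from-head = K≤r′ ; i′-inside = r′<k }

    module _ {i i′ : ℤ} (inv : Inversion i i′) where
      open Inversion inv
      open ZP.≤-Reasoning

      private
        M : ℤ
        M = block i
        b a : ℕ
        b = suc (offset i N.+ J)
        a = suc (offset i′ N.∸ K)
        Ψi : Ψ i ≡ x b + M * + n
        Ψi = Ψ-at (rotate-tail i-from-tail) refl
        Ψi′ : Ψ i′ ≡ x a + M * + n
        Ψi′ = Ψ-at (rotate-head i′-from-head i′-inside) (sym same-block)
        a≤J : a N.≤ J
        a≤J = head∸K<J i′-from-head i′-inside
        J<b : J N.< b
        J<b = s≤s (NP.m≤n+m J (offset i))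
        b≤k : b N.≤ k
        b≤k = tail+J<k i-from-tail
        J<k : J N.< k
        J<k = NP.<-≤-trans J<b b≤k

      inversion-ascent : Ψ i < Ψ i′
      inversion-ascent = subst₂ _<_ (sym Ψi) (sym Ψi′)
        (ZP.+-monoˡ-< (M * + n) (x-decreasing (s≤s z≤n) (NP.≤-<-trans a≤J J<b) b≤k))

      inversion-left-below : ∀ t → t < i → Ψ t < Ψ i′
      inversion-left-below t t<i with <-lex t<i
      ... | inj₁ Mt<M = subst₂ _<_ (sym (Ψ≡w∘σ t)) (sym Ψi′) (begin-strict
        w (σ t)         <⟨ below-shifted left-below M (σ t)
                             (position-before-block (rotate-< k≤n (offset<n t)) Mt<M) ⟩
        x J + M * + n   ≤⟨ ZP.+-monoˡ-≤ (M * + n) (x-antitone (s≤s z≤n) a≤J J≤k) ⟩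
        x a + M * + n   ∎)
      ... | inj₂ (Mt≡M , rt<r) = subst₂ _<_ (sym (Ψ-at (rotate-tail rt<K) Mt≡M)) (sym Ψi′)
        (ZP.+-monoˡ-< (M * + n)
          (x-decreasing (s≤s z≤n) (NP.≤-<-trans a≤J (s≤s (NP.m≤n+m J (offset t)))) (tail+J<k rt<K)))
        where
        rt<K : offset t N.< K
        rt<K = NP.<-trans rt<r i-from-tail

      inversion-right-above : ∀ t → i′ < t → Ψ i < Ψ t
      inversion-right-above t i′<t with <-lex i′<t
      ... | inj₁ M′<Mt = subst₂ _<_ (sym Ψi) (sym (Ψ≡w∘σ t)) (begin-strict
        x b + M * + n                ≤⟨ ZP.+-monoˡ-≤ (M * + n) (x-antitone (s≤s z≤n) J<b b≤k) ⟩
        x (suc J) + M * + n          ≡⟨ cong (λ M → x (suc J) + M * + n) same-block ⟩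
        x (suc J) + block i′ * + n   <⟨ above-shifted (right-above J<k) (block i′) (σ t)
                                          (position-after-block k≤n M′<Mt) ⟩
        w (σ t)                      ∎)
      ... | inj₂ (M′≡Mt , r′<rt) with part (offset t)
      ...   | from-tail rt<K = ⊥-elim (NP.<-asym r′<rt (NP.<-≤-trans rt<K i′-from-head))
      ...   | from-head K≤rt rt<k = subst₂ _<_ (sym Ψi) (sym (Ψ-at (rotate-head K≤rt rt<k) Mt≡M))
        (ZP.+-monoˡ-< (M * + n) (x-decreasing (s≤s z≤n) (NP.≤-<-trans (head∸K<J K≤rt rt<k) J<b) b≤k))
        where
        Mt≡M : block t ≡ M
        Mt≡M = sym (trans same-block M′≡Mt)
      ...   | outside k≤rt = subst₂ _<_ (sym Ψi) (sym (Ψ-at (rotate-outside k≤rt) Mt≡M))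
        (ZP.+-monoˡ-< (M * + n) (begin-strict
          x b                ≤⟨ x-antitone (s≤s z≤n) J<b b≤k ⟩
          x (suc J)          <⟨ right-above J<k (q + + suc (offset t)) (ZP.+-monoʳ-< q (+<+ (s≤s k≤rt))) ⟩
          x (suc (offset t)) ∎))
        where
        Mt≡M : block t ≡ M
        Mt≡M = sym (trans same-block M′≡Mt)

      inversion-separating : SeparatingAscent Ψ i i′
      inversion-separating = record
        { ascent      = inversion-ascent
        ; left-below  = inversion-left-below
        ; right-above = inversion-right-above
        }

    Ψ-avoids : ∀ {m} {p : Fin (suc m) → ℕ} →
               (∀ {f} → Increasing f → SameOrder p (Ψ ∘ f) →
                ∀ a → ¬ SeparatingAscent Ψ (f (inject₁ a)) (f (Fin.suc a))) →
               Avoids w (suc m) p → Avoids Ψ (suc m) p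
    Ψ-avoids = avoids-reindex {w = w} {Ψ} {σ} Ψ≡w∘σ
                 (λ i<i′ σi≮σi′ → inversion-separating (σ-inversion i<i′ σi≮σi′))

module PivotChoice {w : ℤ → ℤ} (injective : ∀ a b → w a ≡ w b → a ≡ b)
                   {q : ℤ} {k : ℕ} (fs : IsFactoringSubword w q k) where
  open IsFactoringSubword fs

  q<q+s : ∀ {s} → 1 N.≤ s → q < q + + s
  q<q+s {s} 1≤s = subst (_< q + + s) (ZP.+-identityʳ q) (ZP.+-monoʳ-< q (+<+ 1≤s))

  unexceeded⇒below : ∀ {s} → 1 N.≤ s → NoExceed w q s → ∀ u → u ≤ q → w u < xval w q s
  unexceeded⇒below {s} 1≤s unexceeded u u≤q = ZP.≤∧≢⇒< (ZP.≮⇒≥ (unexceeded u u≤q))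
    (λ wu≡xs → ZP.<⇒≱ (q<q+s 1≤s) (subst (_≤ q) (injective u (q + + s) wu≡xs) u≤q))

  last-unexceeded⇒first-valid : NoExceed w q k → IsValidPivot w q k 1
  last-unexceeded⇒first-valid unexceeded = record
    { 1≤J         = s≤s z≤n
    ; J≤k         = k≥1
    ; left-below  = left
    ; right-above = λ 1<k u q+k<u → ZP.<-trans (decreasing 1 (s≤s z≤n) 1<k)
                                               (cond4 (unexceeded⇒below k≥1 unexceeded) u q+k<u)
    }

  -- A value right of x below x_{j+1} would leave x_{j+1} unexceeded: a value left of x above
  -- x_{j+1} would form a 3412 with x_j and x_k.
  largest-unexceeded-valid : Avoids w 4 p3412 → ∀ {j} → j N.< k → IsLargestNoExceed w q k j →
                             IsValidPivot w q k j
  largest-unexceeded-valid avoids {j} j<k (1≤j , j≤k , unexceeded , largest) = record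
    { 1≤J         = 1≤j
    ; J≤k         = j≤k
    ; left-below  = below
    ; right-above = λ _ → above
    }
    where
    below : ∀ u → u ≤ q → w u < xval w q j
    below = unexceeded⇒below 1≤j unexceeded

    above : ∀ u → q + + k < u → xval w q (suc j) < w u
    above u q+k<u with xval w q (suc j) ZP.<? w u
    ... | yes xⱼ₊₁<wu = xⱼ₊₁<wu
    ... | no xⱼ₊₁≮wu = ⊥-elim (largest (suc j) NP.≤-refl j<k unexceeded′)
      where
      wu<xⱼ₊₁ : w u < xval w q (suc j)
      wu<xⱼ₊₁ = ZP.≤∧≢⇒< (ZP.≮⇒≥ xⱼ₊₁≮wu) λ wu≡xⱼ₊₁ →
        ZP.<-irrefl (sym (injective _ _ wu≡xⱼ₊₁)) (ZP.≤-<-trans (ZP.+-monoʳ-≤ q (+≤+ j<k)) q+k<u)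

      unexceeded′ : NoExceed w q (suc j)
      unexceeded′ i i≤q xⱼ₊₁<wi = avoids (occurrence-3412
        (ZP.≤-<-trans i≤q (q<q+s 1≤j)) (ZP.+-monoʳ-< q (+<+ j<k)) q+k<u
        (right u q+k<u) (ZP.<-trans wu<xⱼ₊₁ xⱼ₊₁<wi) (below i i≤q))

  pivot-valid : Avoids w 4 p3412 → ∀ {j} → IsLargestNoExceed w q k j → IsValidPivot w q k (pivotFrom k j)
  pivot-valid avoids {j} largest@(_ , j≤k , unexceeded , _) with j N.≟ k
  ... | yes refl = last-unexceeded⇒first-valid unexceeded
  ... | no j≢k   = largest-unexceeded-valid avoids (NP.≤∧≢⇒< j≤k j≢k) largest

lemma3p10 : (n : ℕ) → .{{_ : NonZero n}} → (w : ℤ → ℤ) → IsAffinePerm n w →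
            Avoids w 4 p3412 → Avoids w 4 p4231 →
            (q : ℤ) (k : ℕ) → IsFactoringSubword w q k →
            (j : ℕ) → IsLargestNoExceed w q k j →
            Avoids (Psi n w q k (pivotFrom k j)) 4 p3412 ×
            Avoids (Psi n w q k (pivotFrom k j)) 4 p4231
lemma3p10 n w affine avoids-3412 avoids-4231 q k fs j largest =
  Ψ-avoids p3412-no-separating-ascent avoids-3412 , Ψ-avoids p4231-no-separating-ascent avoids-4231
  where
  open IsAffinePerm affine
  open FactoringSubword n periodic fs
  open Rotated (PivotChoice.pivot-valid injective fs avoids-3412 largest)
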